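{- Let $q\ge 1$ and $n$ be integers with $n\ge q-1$, let $a_1,\dots,a_n\in\mathbb{Z}_q$ be reduced residues (i.e. $\gcd(a_i,q)=1$ for all $i$), and let $\rho\in\mathbb{Z}_q$. Then the number of the $2^n$ choices $(\varepsilon_1,\dots,\varepsilon_n)\in\{0,1\}^n$ with $\sum_{i=1}^n\varepsilon_i a_i\equiv \rho\pmod q$ is at least $\binom{n}{\lceil (n-q)/2\rceil}_q$. Moreover this bound is best possible: for all such $n,q$ there exist reduced residues $a_1,\dots,a_n$ and $\rho\in\mathbb{Z}_q$ for which equality holds.
   Context: $\mathbb{Z}_q$ denotes the integers modulo $q$. For integers $n\ge 0$ and $s$, the mod $q$ binomial coefficient is $\binom{n}{s}_q=|\{A\subseteq\{1,\dots,n\}: |A|\equiv s \pmod q\}|=\sum_{j\equiv s \pmod q}\binom{n}{j}$ (sum over integers $j$ with $0\le j\le n$). -}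

module Defs where

open import Data.Nat using (ℕ; zero; suc; _+_; _*_; _∸_; _≤_; NonZero)
open import Data.Nat.DivMod using (_%_; _/_)
open import Data.Nat.Combinatorics using (_C_)
open import Data.Nat.Coprimality using (Coprime)
open import Data.Nat.Properties using (_≟_)
open import Data.Bool using (Bool; true; false)
open import Data.Fin using (Fin; toℕ)
open import Data.Vec using (Vec; []; _∷_)
open import Data.List using (List; []; _∷_; map; _++_; length; filter; upTo)
open import Data.Nat.ListAction using (sum)
open import Relation.Binary.PropositionalEquality using (_≡_)

allBoolVecs : (n : ℕ) → List (Vec Bool n)
allBoolVecs zero    = [] ∷ []
allBoolVecs (suc n) = map (false ∷_) (allBoolVecs n) ++ map (true ∷_) (allBoolVecs n)

weightedSum : ∀ {q n} → Vec Bool n → Vec (Fin q) n → ℕ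
weightedSum []          []       = 0
weightedSum (false ∷ e) (_ ∷ as) = weightedSum e as
weightedSum (true  ∷ e) (x ∷ as) = toℕ x + weightedSum e as

countSols : (q : ℕ) .{{_ : NonZero q}} → ∀ {n} → Vec (Fin q) n → Fin q → ℕ
countSols q {n} a ρ =
  length (filter (λ e → weightedSum e a % q ≟ toℕ ρ) (allBoolVecs n))

binomMod : (q : ℕ) .{{_ : NonZero q}} → (n s : ℕ) → ℕ
binomMod q n s = sum (map (λ j → n C j) (filter (λ j → j % q ≟ s % q) (upTo (suc n))))

-- ⌈(n - q)/2⌉ for n ≥ q - 1 (then n - q ≥ -1, and the ceiling is ≥ 0):
-- equals ⌊(n ∸ q + 1)/2⌋ (for n = q - 1: ⌈-1/2⌉ = 0 = ⌊1/2⌋).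
ceilHalfDiff : (n q : ℕ) → ℕ
ceilHalfDiff n q = suc (n ∸ q) / 2

Reduced : {q : ℕ} → Fin q → Set
Reduced {q} x = Coprime (toℕ x) q

-- Write N_a(r) for the number of ε ∈ {0,1}ⁿ with Σ εᵢ aᵢ ≡ r, so that N_{x∷a}(r) = N_a(r) + N_a(r − x).
-- Let L_n(k) be the sum of the k smallest values of r ↦ binom(n, r)_q, the values of N for
-- a = (1, …, 1); they satisfy L_{n+1}(k) = L_n(k + 1) + L_n(k − 1) and are convex in k.
-- By induction on n, Σ_{r ∈ S} N_a(r) ≥ L_n(|S|) for every S ⊆ ℤ_q: in the step,
-- Σ_S N_{x∷a} = Σ_S N_a + Σ_{S−x} N_a = Σ_{S∪(S−x)} N_a + Σ_{S∩(S−x)} N_a, and since x is a unit a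
-- nonempty proper S is not invariant under translation by x, so |S ∩ (S − x)| < |S| and convexity
-- applies. For S = {ρ} this gives N_a(ρ) ≥ L_n(1) = binom(n, ⌈(n − q)/2⌉)_q, attained by a = (1, …, 1).
module Submission where

open import Defs
open import Data.Nat using (ℕ; _∸_; _≤_; NonZero)
open import Data.Fin using (Fin)
open import Data.Vec using (Vec)
open import Data.Vec.Relation.Unary.All using (All)
open import Data.Product using (Σ; _×_)
open import Relation.Binary.PropositionalEquality using (_≡_)

open import Data.Bool using (Bool; true; false; not; _∧_; _∨_; if_then_else_; T)
open import Data.Empty using (⊥; ⊥-elim; ⊥-elim-irr)
open import Data.Fin using (toℕ; fromℕ<) renaming (zero to fzero; suc to fsuc)
open import Data.Fin.Properties using (toℕ<n; toℕ-fromℕ<)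
open import Data.List using ([]; _∷_; map; filter; applyUpTo; _++_; length)
open import Data.List.Properties using (filter-++; length-++)
open import Data.Nat
open import Data.Nat.Combinatorics using (_C_; nCk+nC[k+1]≡[n+1]C[k+1]; nCk≡nC[n∸k])
open import Data.Nat.Combinatorics.Specification using (k>n⇒nCk≡0)
open import Data.Nat.Coprimality using (Coprime; coprime-Bézout; 1-coprimeTo) renaming (sym to coprime-sym)
open import Data.Nat.DivMod
open import Data.Nat.GCD using (module Bézout)
open import Data.Nat.ListAction using (sum)
open import Data.Nat.Properties
open import Data.Nat.Tactic.RingSolver using (solve-∀)
open import Data.Product using (proj₁; proj₂; _,_)
open import Data.Sum using (_⊎_; inj₁; inj₂)
open import Data.Unit using (tt)
open import Data.Vec using ([]; _∷_)
open import Data.Vec.Relation.Unary.All using ([]; _∷_)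
open import Level using (0ℓ)
open import Relation.Binary.PropositionalEquality
open import Relation.Nullary using (Dec; yes; no; does)
open import Relation.Unary using (Pred; Decidable)

sumTo : (ℕ → ℕ) → ℕ → ℕ
sumTo f zero    = 0
sumTo f (suc m) = sumTo f m + f m

module _ {f g : ℕ → ℕ} where

  sumTo-cong : ∀ m → (∀ j → j < m → f j ≡ g j) → sumTo f m ≡ sumTo g m
  sumTo-cong zero    f≡g = refl
  sumTo-cong (suc m) f≡g = cong₂ _+_ (sumTo-cong m (λ j j<m → f≡g j (m<n⇒m<1+n j<m))) (f≡g m ≤-refl)

  sumTo-mono-≤ : ∀ m → (∀ j → j < m → f j ≤ g j) → sumTo f m ≤ sumTo g m
  sumTo-mono-≤ zero    f≤g = z≤n
  sumTo-mono-≤ (suc m) f≤g = +-mono-≤ (sumTo-mono-≤ m (λ j j<m → f≤g j (m<n⇒m<1+n j<m))) (f≤g m ≤-refl)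

  sumTo-mono-< : ∀ m {y} → (∀ j → j < m → f j ≤ g j) → y < m → f y < g y → sumTo f m < sumTo g m
  sumTo-mono-< (suc m) {y} f≤g y<1+m fy<gy with m≤n⇒m<n∨m≡n (≤-pred y<1+m)
  ... | inj₁ y<m  = +-mono-<-≤ (sumTo-mono-< m (λ j j<m → f≤g j (m<n⇒m<1+n j<m)) y<m fy<gy) (f≤g m ≤-refl)
  ... | inj₂ refl = +-mono-≤-< (sumTo-mono-≤ y (λ j j<y → f≤g j (m<n⇒m<1+n j<y))) fy<gy

  sumTo-distrib-+ : ∀ m → sumTo (λ j → f j + g j) m ≡ sumTo f m + sumTo g m
  sumTo-distrib-+ zero    = refl
  sumTo-distrib-+ (suc m) rewrite sumTo-distrib-+ m = +-+-interchange (sumTo f m) (sumTo g m) (f m) (g m)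
    where
    +-+-interchange : ∀ a b c d → a + b + (c + d) ≡ a + c + (b + d)
    +-+-interchange = solve-∀

sumTo-head : ∀ f m → sumTo f (suc m) ≡ f 0 + sumTo (λ j → f (suc j)) m
sumTo-head f zero    = +-comm 0 (f 0)
sumTo-head f (suc m) rewrite sumTo-head f m = +-assoc (f 0) _ _

sumTo-reverse : ∀ f n → sumTo f (suc n) ≡ sumTo (λ j → f (n ∸ j)) (suc n)
sumTo-reverse f zero    = refl
sumTo-reverse f (suc n) = begin
  sumTo f (suc n) + f (suc n)                   ≡⟨ cong (_+ f (suc n)) (sumTo-reverse f n) ⟩
  sumTo (λ j → f (n ∸ j)) (suc n) + f (suc n)   ≡⟨ +-comm _ (f (suc n)) ⟩
  f (suc n) + sumTo (λ j → f (n ∸ j)) (suc n)   ≡⟨ sumTo-head (λ j → f (suc n ∸ j)) (suc n) ⟨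
  sumTo (λ j → f (suc n ∸ j)) (suc (suc n))     ∎
  where open ≡-Reasoning

sumTo-const : ∀ c m → sumTo (λ _ → c) m ≡ m * c
sumTo-const c zero    = refl
sumTo-const c (suc m) rewrite sumTo-const c m = +-comm (m * c) c

term≤sumTo : ∀ f {m y} → y < m → f y ≤ sumTo f m
term≤sumTo f {suc m} y<1+m with m≤n⇒m<n∨m≡n (≤-pred y<1+m)
... | inj₁ y<m  = ≤-trans (term≤sumTo f y<m) (m≤m+n _ _)
... | inj₂ refl = m≤n+m _ _

sumTo-convex : ∀ {f : ℕ → ℕ} → (∀ {i j} → i ≤ j → f i ≤ f j) →
  ∀ m w → sumTo f (2 + (m + w)) + sumTo f (m + w) ≤ sumTo f (m + (2 + (w + w))) + sumTo f m
sumTo-convex {f} f-mono m zero rewrite +-identityʳ m | +-comm m 2 = ≤-refl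
sumTo-convex {f} f-mono m (suc w) = begin
  sumTo f (2 + (m + suc w)) + sumTo f (m + suc w)
    ≡⟨ cong₂ (λ a b → sumTo f (2 + a) + sumTo f b) (+-suc m w) (+-suc m w) ⟩
  sumTo f (2 + (suc m + w)) + sumTo f (suc m + w)
    ≤⟨ sumTo-convex f-mono (suc m) w ⟩
  sumTo f far + (sumTo f m + f m)
    ≤⟨ +-monoʳ-≤ (sumTo f far) (+-monoʳ-≤ (sumTo f m) (f-mono (≤-trans (n≤1+n m) (m≤m+n (suc m) _)))) ⟩
  sumTo f far + (sumTo f m + f far)
    ≡⟨ +-comm-middle (sumTo f far) (sumTo f m) (f far) ⟩
  sumTo f (suc far) + sumTo f m
    ≡⟨ cong (λ z → sumTo f z + sumTo f m) (suc-far m w) ⟩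
  sumTo f (m + (2 + (suc w + suc w))) + sumTo f m
    ∎
  where
  open ≤-Reasoning
  far = suc m + (2 + (w + w))
  +-comm-middle : ∀ a b c → a + (b + c) ≡ a + c + b
  +-comm-middle = solve-∀
  suc-far : ∀ m w → suc (suc m + (2 + (w + w))) ≡ m + (2 + (suc w + suc w))
  suc-far = solve-∀

when : Bool → ℕ → ℕ
when b v = if b then v else 0

when-distrib-+ : ∀ b u v → when b (u + v) ≡ when b u + when b v
when-distrib-+ true  u v = refl
when-distrib-+ false u v = refl

when-∨-∧ : ∀ a b v → when a v + when b v ≡ when (a ∨ b) v + when (a ∧ b) v
when-∨-∧ true  true  v = refl
when-∨-∧ true  false v = refl
when-∨-∧ false true  v = +-comm 0 v
when-∨-∧ false false v = refl

when≤1 : ∀ b → when b 1 ≤ 1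
when≤1 true  = ≤-refl
when≤1 false = z≤n

when-∧-≤ : ∀ a b → when (a ∧ b) 1 ≤ when a 1
when-∧-≤ true  b = when≤1 b
when-∧-≤ false b = z≤n

sumTo-indicator-below : ∀ (g : ℕ → ℕ) {r} m → m ≤ r → sumTo (λ x → when (x ≡ᵇ r) (g x)) m ≡ 0
sumTo-indicator-below g zero    _ = refl
sumTo-indicator-below g {r} (suc m) m<r with m ≡ᵇ r in m≡ᵇr
... | true  = ⊥-elim (<-irrefl (≡ᵇ⇒≡ m r (subst T (sym m≡ᵇr) tt)) m<r)
... | false = trans (+-identityʳ _) (sumTo-indicator-below g m (<⇒≤ m<r))

sumTo-indicator : ∀ (g : ℕ → ℕ) {r} m → r < m → sumTo (λ x → when (x ≡ᵇ r) (g x)) m ≡ g r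
sumTo-indicator g {r} (suc m) r<1+m with m ≡ᵇ r in m≡ᵇr
... | true  with refl ← ≡ᵇ⇒≡ m r (subst T (sym m≡ᵇr) tt) = cong (_+ g m) (sumTo-indicator-below g m ≤-refl)
... | false = trans (+-identityʳ _) (sumTo-indicator g m (≤∧≢⇒< (≤-pred r<1+m) r≢m))
  where
  r≢m : r ≢ m
  r≢m refl = subst T m≡ᵇr (≡⇒≡ᵇ m m refl)

does-cong : ∀ {A B : Set} → (A → B) → (B → A) → (a? : Dec A) (b? : Dec B) → does a? ≡ does b?
does-cong A→B B→A (yes a) (yes b) = refl
does-cong A→B B→A (yes a) (no ¬b) = ⊥-elim (¬b (A→B a))
does-cong A→B B→A (no ¬a) (yes b) = ⊥-elim (¬a (B→A b))
does-cong A→B B→A (no ¬a) (no ¬b) = refl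

sum-filter≡sumTo : ∀ {P : Pred ℕ 0ℓ} (P? : Decidable P) (g f : ℕ → ℕ) m →
  sum (map g (filter P? (applyUpTo f m))) ≡ sumTo (λ j → when (does (P? (f j))) (g (f j))) m
sum-filter≡sumTo P? g f zero = refl
sum-filter≡sumTo P? g f (suc m)
  rewrite sumTo-head (λ j → when (does (P? (f j))) (g (f j))) m with P? (f 0)
... | yes _ = cong (g (f 0) +_) (sum-filter≡sumTo P? g (λ j → f (suc j)) m)
... | no  _ = sum-filter≡sumTo P? g (λ j → f (suc j)) m

module _ {A : Set} {P Q : Pred A 0ℓ} (P? : Decidable P) (Q? : Decidable Q) where

  length-filter-cong : (∀ x → P x → Q x) → (∀ x → Q x → P x) → ∀ xs →
    length (filter P? xs) ≡ length (filter Q? xs)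
  length-filter-cong P⇒Q Q⇒P []       = refl
  length-filter-cong P⇒Q Q⇒P (x ∷ xs) with P? x | Q? x
  ... | yes _  | yes _  = cong suc (length-filter-cong P⇒Q Q⇒P xs)
  ... | yes px | no ¬qx = ⊥-elim (¬qx (P⇒Q x px))
  ... | no ¬px | yes qx = ⊥-elim (¬px (Q⇒P x qx))
  ... | no _   | no _   = length-filter-cong P⇒Q Q⇒P xs

length-filter-++ : ∀ {A : Set} {P : Pred A 0ℓ} (P? : Decidable P) xs ys →
  length (filter P? (xs ++ ys)) ≡ length (filter P? xs) + length (filter P? ys)
length-filter-++ P? xs ys = trans (cong length (filter-++ P? xs ys)) (length-++ (filter P? xs))

length-filter-map : ∀ {A B : Set} {P : Pred B 0ℓ} (P? : Decidable P) (f : A → B) xs →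
  length (filter P? (map f xs)) ≡ length (filter (λ x → P? (f x)) xs)
length-filter-map P? f []       = refl
length-filter-map P? f (x ∷ xs) with P? (f x)
... | yes _ = cong suc (length-filter-map P? f xs)
... | no  _ = length-filter-map P? f xs

find : (s : ℕ → Bool) (m : ℕ) → (Σ ℕ λ x → x < m × s x ≡ true) ⊎ (∀ x → x < m → s x ≡ false)
find s zero    = inj₂ (λ x ())
find s (suc m) with find s m
... | inj₁ (x , x<m , sx) = inj₁ (x , m<n⇒m<1+n x<m , sx)
... | inj₂ none with s m in sm
...   | true  = inj₁ (m , ≤-refl , sm)
...   | false = inj₂ (λ x x<1+m → below-or-last (m≤n⇒m<n∨m≡n (≤-pred x<1+m)))
  where
  below-or-last : ∀ {x} → x < m ⊎ x ≡ m → s x ≡ false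
  below-or-last (inj₁ x<m) = none _ x<m
  below-or-last (inj₂ refl) = sm

n/2≡⌊n/2⌋ : ∀ n → n / 2 ≡ ⌊ n /2⌋
n/2≡⌊n/2⌋ zero          = refl
n/2≡⌊n/2⌋ (suc zero)    = refl
n/2≡⌊n/2⌋ (suc (suc n)) = trans (m/n≡1+[m∸n]/n {suc (suc n)} {2} (s≤s (s≤s z≤n))) (cong suc (n/2≡⌊n/2⌋ n))

⌊n+[1+p]/2⌋+⌈n∸[1+p]/2⌉≡n : ∀ {p n} → p ≤ n → ⌊ n + suc p /2⌋ + ⌈ n ∸ suc p /2⌉ ≡ n
⌊n+[1+p]/2⌋+⌈n∸[1+p]/2⌉≡n {n = zero}  z≤n = refl
⌊n+[1+p]/2⌋+⌈n∸[1+p]/2⌉≡n {n = suc n} z≤n rewrite +-comm n 1 = cong suc (⌊n/2⌋+⌈n/2⌉≡n n)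
⌊n+[1+p]/2⌋+⌈n∸[1+p]/2⌉≡n {suc p} {suc n} (s≤s p≤n) rewrite +-suc n (suc p) = cong suc (⌊n+[1+p]/2⌋+⌈n∸[1+p]/2⌉≡n p≤n)

atLeast : ℕ → ℕ → ℕ
atLeast zero    i       = 1
atLeast (suc p) zero    = 0
atLeast (suc p) (suc i) = atLeast p i

atLeast-mono : ∀ p {i j} → i ≤ j → atLeast p i ≤ atLeast p j
atLeast-mono zero    i≤j       = ≤-refl
atLeast-mono (suc p) z≤n       = z≤n
atLeast-mono (suc p) (s≤s i≤j) = atLeast-mono p i≤j

atLeast-refl : ∀ p → atLeast p p ≡ 1
atLeast-refl zero    = refl
atLeast-refl (suc p) = atLeast-refl p

atLeast-< : ∀ p {i} → i < p → atLeast p i ≡ 0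
atLeast-< (suc p) {zero}  _         = refl
atLeast-< (suc p) {suc i} (s≤s i<p) = atLeast-< p i<p

-- The residue 1, which is 0 when q = 1.
one : ∀ p → Fin (suc p)
one zero    = fzero
one (suc p) = fsuc fzero

one-coprime : ∀ p → Coprime (toℕ (one p)) (suc p)
one-coprime zero    = coprime-sym (1-coprimeTo 0)
one-coprime (suc p) = 1-coprimeTo (suc (suc p))

r+[q∸one]≈r+p : ∀ p r → (r + (suc p ∸ toℕ (one p))) % suc p ≡ (r + p) % suc p
r+[q∸one]≈r+p zero    r = trans (n%1≡0 (r + 1)) (sym (n%1≡0 (r + 0)))
r+[q∸one]≈r+p (suc p) r = refl

-- Arithmetic in ℤ_q for q = suc p

module _ (p : ℕ) where
  private
    q : ℕ
    q = suc p

  infix 4 _≈_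
  _≈_ : ℕ → ℕ → Set
  x ≈ y = x % q ≡ y % q

  [m%q+n]%q≡[m+n]%q : ∀ m n → (m % q + n) % q ≡ (m + n) % q
  [m%q+n]%q≡[m+n]%q m n = begin
    (m % q + n) % q          ≡⟨ %-distribˡ-+ (m % q) n q ⟩
    (m % q % q + n % q) % q  ≡⟨ cong (λ z → (z + n % q) % q) (m%n%n≡m%n m q) ⟩
    (m % q + n % q) % q      ≡⟨ %-distribˡ-+ m n q ⟨
    (m + n) % q              ∎
    where open ≡-Reasoning

  ≈-+ʳ : ∀ x y z → x ≈ y → x + z ≈ y + z
  ≈-+ʳ x y z x≈y = begin
    (x + z) % q      ≡⟨ [m%q+n]%q≡[m+n]%q x z ⟨
    (x % q + z) % q  ≡⟨ cong (λ w → (w + z) % q) x≈y ⟩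
    (y % q + z) % q  ≡⟨ [m%q+n]%q≡[m+n]%q y z ⟩
    (y + z) % q      ∎
    where open ≡-Reasoning

  ≈-+ˡ : ∀ x y z → x ≈ y → z + x ≈ z + y
  ≈-+ˡ x y z x≈y rewrite +-comm z x | +-comm z y = ≈-+ʳ x y z x≈y

  ≈-*ˡ : ∀ x y z → x ≈ y → z * x ≈ z * y
  ≈-*ˡ x y z x≈y = begin
    (z * x) % q                ≡⟨ %-distribˡ-* z x q ⟩
    ((z % q) * (x % q)) % q    ≡⟨ cong (λ w → ((z % q) * w) % q) x≈y ⟩
    ((z % q) * (y % q)) % q    ≡⟨ %-distribˡ-* z y q ⟨
    (z * y) % q                ∎
    where open ≡-Reasoning

  +-cancelʳ-≈ : ∀ x y z → x + z ≈ y + z → x ≈ y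
  +-cancelʳ-≈ x y z x+z≈y+z = begin
    x % q                ≡⟨ [m+kn]%n≡m%n x z q ⟨
    (x + z * q) % q      ≡⟨ cong (_% q) (split-q x z p) ⟩
    (x + z + z * p) % q  ≡⟨ ≈-+ʳ (x + z) (y + z) (z * p) x+z≈y+z ⟩
    (y + z + z * p) % q  ≡⟨ cong (_% q) (split-q y z p) ⟨
    (y + z * q) % q      ≡⟨ [m+kn]%n≡m%n y z q ⟩
    y % q                ∎
    where
    open ≡-Reasoning
    split-q : ∀ w z p → w + z * suc p ≡ w + z + z * p
    split-q = solve-∀

  +-cancelˡ-≈ : ∀ x y z → z + x ≈ z + y → x ≈ y
  +-cancelˡ-≈ x y z rewrite +-comm z x | +-comm z y = +-cancelʳ-≈ x y z

  m+q≈m : ∀ m → m + q ≈ m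
  m+q≈m m = [m+n]%n≡m%n m q

  m+n+[q∸n]≈m : ∀ m {n} → n ≤ q → m + n + (q ∸ n) ≈ m
  m+n+[q∸n]≈m m {n} n≤q = trans (cong (_% q) (trans (+-assoc m n (q ∸ n)) (cong (m +_) (m+[n∸m]≡n n≤q)))) (m+q≈m m)

  coprime⇒invertible : ∀ {x} → Coprime x q → Σ ℕ λ u → u * x ≈ 1
  coprime⇒invertible {x} x⊥q with coprime-Bézout x⊥q
  ... | Bézout.+- u v 1+vq≡ux = u , (begin
    (u * x) % q      ≡⟨ cong (_% q) 1+vq≡ux ⟨
    (1 + v * q) % q  ≡⟨ [m+kn]%n≡m%n 1 v q ⟩
    1 % q            ∎)
    where open ≡-Reasoning
  -- Here u x ≡ −1 and p ≡ −1, so p u is an inverse.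
  ... | Bézout.-+ u v 1+ux≡vq = p * u , (begin
    (p * u * x) % q            ≡⟨ m+q≈m (p * u * x) ⟨
    (p * u * x + q) % q        ≡⟨ cong (_% q) (shuffle p u x) ⟩
    (p * (1 + u * x) + 1) % q  ≡⟨ cong (λ w → (p * w + 1) % q) 1+ux≡vq ⟩
    (p * (v * q) + 1) % q      ≡⟨ cong (_% q) (regroup p v q) ⟩
    (1 + (p * v) * q) % q      ≡⟨ [m+kn]%n≡m%n 1 (p * v) q ⟩
    1 % q                      ∎)
    where
    open ≡-Reasoning
    shuffle : ∀ p u x → p * u * x + suc p ≡ p * (1 + u * x) + 1
    shuffle = solve-∀
    regroup : ∀ p v q → p * (v * q) + 1 ≡ 1 + (p * v) * q
    regroup = solve-∀

  coprime⇒solvable : ∀ {x} → Coprime x q → ∀ d → Σ ℕ λ t → t * x ≈ d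
  coprime⇒solvable {x} x⊥q d with coprime⇒invertible x⊥q
  ... | u , ux≈1 = d * u , (begin
    (d * u * x) % q    ≡⟨ cong (_% q) (*-assoc d u x) ⟩
    (d * (u * x)) % q  ≡⟨ ≈-*ˡ (u * x) 1 d ux≈1 ⟩
    (d * 1) % q        ≡⟨ cong (_% q) (*-identityʳ d) ⟩
    d % q              ∎)
    where open ≡-Reasoning

  -- Binomial coefficients modulo q, and the solution counts

  binomTerm : ℕ → ℕ → ℕ → ℕ
  binomTerm n s j = when (does (j % q ≟ s % q)) (n C j)

  binomMod≡sumTo : ∀ n s → binomMod q n s ≡ sumTo (binomTerm n s) (suc n)
  binomMod≡sumTo n s = sum-filter≡sumTo (λ j → j % q ≟ s % q) (n C_) (λ j → j) (suc n)

  binomTerm-cong : ∀ n s t → s ≈ t → ∀ j → binomTerm n s j ≡ binomTerm n t j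
  binomTerm-cong n s t s≈t j =
    cong (λ b → when b (n C j)) (does-cong (λ e → trans e s≈t) (λ e → trans e (sym s≈t)) (j % q ≟ _) (j % q ≟ _))

  binomMod-cong : ∀ n s t → s ≈ t → binomMod q n s ≡ binomMod q n t
  binomMod-cong n s t s≈t = begin
    binomMod q n s                  ≡⟨ binomMod≡sumTo n s ⟩
    sumTo (binomTerm n s) (suc n)   ≡⟨ sumTo-cong (suc n) (λ j _ → binomTerm-cong n s t s≈t j) ⟩
    sumTo (binomTerm n t) (suc n)   ≡⟨ binomMod≡sumTo n t ⟨
    binomMod q n t                  ∎
    where open ≡-Reasoning

  binomTerm-pascal : ∀ n s j → binomTerm (suc n) (suc s) (suc j) ≡ binomTerm n s j + binomTerm n (suc s) (suc j)
  binomTerm-pascal n s j = begin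
    when b (suc n C suc j)                     ≡⟨ cong (when b) (nCk+nC[k+1]≡[n+1]C[k+1] n j) ⟨
    when b (n C j + n C suc j)                 ≡⟨ when-distrib-+ b (n C j) (n C suc j) ⟩
    when b (n C j) + when b (n C suc j)        ≡⟨ cong (λ b′ → when b′ (n C j) + when b (n C suc j)) b≡ ⟩
    binomTerm n s j + binomTerm n (suc s) (suc j)  ∎
    where
    open ≡-Reasoning
    b = does (suc j % q ≟ suc s % q)
    b≡ : b ≡ does (j % q ≟ s % q)
    b≡ = does-cong (+-cancelˡ-≈ j s 1) (≈-+ˡ j s 1) (suc j % q ≟ suc s % q) (j % q ≟ s % q)

  binomTerm-beyond : ∀ n s → binomTerm n s (suc n) ≡ 0
  binomTerm-beyond n s with does (suc n % q ≟ s % q)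
  ... | true  = k>n⇒nCk≡0 (n<1+n n)
  ... | false = refl

  binomMod-pascal : ∀ n s → binomMod q (suc n) (suc s) ≡ binomMod q n (suc s) + binomMod q n s
  binomMod-pascal n s = begin
    binomMod q (suc n) (suc s)
      ≡⟨ binomMod≡sumTo (suc n) (suc s) ⟩
    sumTo (binomTerm (suc n) (suc s)) (suc (suc n))
      ≡⟨ sumTo-head (binomTerm (suc n) (suc s)) (suc n) ⟩
    binomTerm n (suc s) 0 + sumTo (λ j → binomTerm (suc n) (suc s) (suc j)) (suc n)
      ≡⟨ cong (binomTerm n (suc s) 0 +_) (trans (sumTo-cong (suc n) (λ j _ → binomTerm-pascal n s j))
                                                (sumTo-distrib-+ (suc n))) ⟩
    binomTerm n (suc s) 0 + (sumTo (binomTerm n s) (suc n) + tail)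
      ≡⟨ swap (binomTerm n (suc s) 0) _ tail ⟩
    (binomTerm n (suc s) 0 + tail) + sumTo (binomTerm n s) (suc n)
      ≡⟨ cong₂ _+_ (sumTo-head (binomTerm n (suc s)) (suc n)) (binomMod≡sumTo n s) ⟨
    sumTo (binomTerm n (suc s)) (suc n) + binomTerm n (suc s) (suc n) + binomMod q n s
      ≡⟨ cong (λ z → sumTo (binomTerm n (suc s)) (suc n) + z + binomMod q n s) (binomTerm-beyond n (suc s)) ⟩
    sumTo (binomTerm n (suc s)) (suc n) + 0 + binomMod q n s
      ≡⟨ cong (_+ binomMod q n s) (trans (+-identityʳ _) (sym (binomMod≡sumTo n (suc s)))) ⟩
    binomMod q n (suc s) + binomMod q n s
      ∎
    where
    open ≡-Reasoning
    tail = sumTo (λ j → binomTerm n (suc s) (suc j)) (suc n)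
    swap : ∀ a b c → a + (b + c) ≡ a + c + b
    swap = solve-∀

  binomMod-sym : ∀ n s t → s + t ≈ n → binomMod q n s ≡ binomMod q n t
  binomMod-sym n s t s+t≈n = begin
    binomMod q n s                            ≡⟨ binomMod≡sumTo n s ⟩
    sumTo (binomTerm n s) (suc n)             ≡⟨ sumTo-reverse (binomTerm n s) n ⟩
    sumTo (λ j → binomTerm n s (n ∸ j)) (suc n) ≡⟨ sumTo-cong (suc n) reflect ⟩
    sumTo (binomTerm n t) (suc n)             ≡⟨ binomMod≡sumTo n t ⟨
    binomMod q n t                            ∎
    where
    open ≡-Reasoning
    reflect : ∀ j → j < suc n → binomTerm n s (n ∸ j) ≡ binomTerm n t j
    reflect j j<1+n = cong₂ when (does-cong to from ((n ∸ j) % q ≟ s % q) (j % q ≟ t % q))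
                                 (sym (nCk≡nC[n∸k] (≤-pred j<1+n)))
      where
      n∸j+j≈s+t : (n ∸ j) + j ≈ s + t
      n∸j+j≈s+t = trans (cong (_% q) (m∸n+n≡m (≤-pred j<1+n))) (sym s+t≈n)
      to : n ∸ j ≈ s → j ≈ t
      to n∸j≈s = +-cancelˡ-≈ j t (n ∸ j) (trans n∸j+j≈s+t (sym (≈-+ʳ (n ∸ j) s t n∸j≈s)))
      from : j ≈ t → n ∸ j ≈ s
      from j≈t = +-cancelʳ-≈ (n ∸ j) s t (trans (sym (≈-+ˡ j t (n ∸ j) j≈t)) n∸j+j≈s+t)

  solutions : ∀ {n} → Vec (Fin q) n → ℕ → ℕ
  solutions {n} a r = length (filter (λ e → weightedSum e a % q ≟ r % q) (allBoolVecs n))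

  countSols≡solutions : ∀ {n} (a : Vec (Fin q) n) ρ → countSols q a ρ ≡ solutions a (toℕ ρ)
  countSols≡solutions {n} a ρ = length-filter-cong _ _ (λ _ e → trans e (sym ρ%q≡ρ)) (λ _ e → trans e ρ%q≡ρ) (allBoolVecs n)
    where
    ρ%q≡ρ : toℕ ρ % q ≡ toℕ ρ
    ρ%q≡ρ = m<n⇒m%n≡m (toℕ<n ρ)

  solutions-cong : ∀ {n} (a : Vec (Fin q) n) r r′ → r ≈ r′ → solutions a r ≡ solutions a r′
  solutions-cong {n} a r r′ r≈r′ = length-filter-cong _ _ (λ _ e → trans e r≈r′) (λ _ e → trans e (sym r≈r′)) (allBoolVecs n)

  solutions-[] : ∀ r → solutions [] r ≡ binomMod q 0 r
  solutions-[] r with 0 ≡ᵇ r % q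
  ... | true  = refl
  ... | false = refl

  -- r + (q ∸ x) stands for r − x.
  solutions-∷ : ∀ {n} x (a : Vec (Fin q) n) r → solutions (x ∷ a) r ≡ solutions a r + solutions a (r + (q ∸ toℕ x))
  solutions-∷ {n} x a r = begin
    solutions (x ∷ a) r
      ≡⟨ length-filter-++ P? (map (false ∷_) V) (map (true ∷_) V) ⟩
    length (filter P? (map (false ∷_) V)) + length (filter P? (map (true ∷_) V))
      ≡⟨ cong₂ _+_ (length-filter-map P? (false ∷_) V) (length-filter-map P? (true ∷_) V) ⟩
    solutions a r + length (filter (λ e → P? (true ∷ e)) V)
      ≡⟨ cong (solutions a r +_) (length-filter-cong _ _ to from V) ⟩
    solutions a r + solutions a (r + (q ∸ toℕ x))
      ∎
    where
    open ≡-Reasoning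
    V = allBoolVecs n
    P? = λ (e : Vec Bool (suc n)) → weightedSum e (x ∷ a) % q ≟ r % q
    X = toℕ x
    X≤q : X ≤ q
    X≤q = <⇒≤ (toℕ<n x)
    to : ∀ e → X + weightedSum e a ≈ r → weightedSum e a ≈ r + (q ∸ X)
    to e X+w≈r = trans (sym (m+n+[q∸n]≈m w X≤q)) (≈-+ʳ (w + X) r (q ∸ X) (trans (cong (_% q) (+-comm w X)) X+w≈r))
      where w = weightedSum e a
    from : ∀ e → weightedSum e a ≈ r + (q ∸ X) → X + weightedSum e a ≈ r
    from e w≈r+[q∸X] = begin
      (X + w) % q              ≡⟨ ≈-+ˡ w (r + (q ∸ X)) X w≈r+[q∸X] ⟩
      (X + (r + (q ∸ X))) % q  ≡⟨ cong (_% q) (trans (sym (+-assoc X r (q ∸ X))) (cong (_+ (q ∸ X)) (+-comm X r))) ⟩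
      (r + X + (q ∸ X)) % q    ≡⟨ m+n+[q∸n]≈m r X≤q ⟩
      r % q                    ∎
      where w = weightedSum e a

  -- The extremal profile

  -- least n lists the values of r ↦ binomMod q n r in increasing order (cf. least-mono, least≡binomMod).
  least : ℕ → ℕ → ℕ
  least zero    i = atLeast p i
  least (suc n) i = least n (i ∸ 1) + least n (suc i ⊓ p)

  leastSum : ℕ → ℕ → ℕ
  leastSum n k = sumTo (least n) k

  least-mono : ∀ n {i j} → i ≤ j → least n i ≤ least n j
  least-mono zero    i≤j = atLeast-mono p i≤j
  least-mono (suc n) i≤j = +-mono-≤ (least-mono n (∸-monoˡ-≤ 1 i≤j)) (least-mono n (⊓-monoˡ-≤ p (s≤s i≤j)))

  leastSum-convex : ∀ n m w → leastSum n (2 + (m + w)) + leastSum n (m + w) ≤ leastSum n (m + (2 + (w + w))) + leastSum n m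
  leastSum-convex n = sumTo-convex (least-mono n)

  leastSum-suc : ∀ n k → suc k < q → leastSum (suc n) (suc k) ≡ leastSum n (2 + k) + leastSum n k
  leastSum-suc n k 1+k<q = begin
    leastSum (suc n) (suc k)
      ≡⟨ sumTo-distrib-+ (suc k) ⟩
    sumTo (λ j → least n (j ∸ 1)) (suc k) + sumTo (λ j → least n (suc j ⊓ p)) (suc k)
      ≡⟨ cong₂ _+_ (sumTo-head (λ j → least n (j ∸ 1)) k)
                   (sumTo-cong (suc k) (λ j j<1+k → cong (least n) (m≤n⇒m⊓n≡m (≤-trans j<1+k (≤-pred 1+k<q))))) ⟩
    (least n 0 + leastSum n k) + sumTo (λ j → least n (suc j)) (suc k)
      ≡⟨ +-comm-middle (least n 0) (leastSum n k) _ ⟩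
    (least n 0 + sumTo (λ j → least n (suc j)) (suc k)) + leastSum n k
      ≡⟨ cong (_+ leastSum n k) (sumTo-head (least n) (suc k)) ⟨
    leastSum n (2 + k) + leastSum n k
      ∎
    where
    open ≡-Reasoning
    +-comm-middle : ∀ a b c → a + b + c ≡ a + c + b
    +-comm-middle = solve-∀

  leastSum-full : ∀ n → leastSum (suc n) q ≡ leastSum n q + leastSum n q
  leastSum-full n = begin
    leastSum (suc n) q
      ≡⟨ sumTo-distrib-+ q ⟩
    sumTo (λ j → least n (j ∸ 1)) q + (sumTo (λ j → least n (suc j ⊓ p)) p + least n (suc p ⊓ p))
      ≡⟨ cong₂ (λ a b → a + (b + least n (suc p ⊓ p))) (sumTo-head (λ j → least n (j ∸ 1)) p)
               (sumTo-cong p (λ j j<p → cong (least n) (m≤n⇒m⊓n≡m j<p))) ⟩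
    (least n 0 + leastSum n p) + (sumTo (λ j → least n (suc j)) p + least n (suc p ⊓ p))
      ≡⟨ cong (λ z → (least n 0 + leastSum n p) + (sumTo (λ j → least n (suc j)) p + least n z)) (m≥n⇒m⊓n≡n (n≤1+n p)) ⟩
    (least n 0 + leastSum n p) + (sumTo (λ j → least n (suc j)) p + least n p)
      ≡⟨ +-+-interchange (least n 0) (leastSum n p) _ (least n p) ⟩
    (least n 0 + sumTo (λ j → least n (suc j)) p) + leastSum n q
      ≡⟨ cong (_+ leastSum n q) (sumTo-head (least n) p) ⟨
    leastSum n q + leastSum n q
      ∎
    where
    open ≡-Reasoning
    +-+-interchange : ∀ a b c d → a + b + (c + d) ≡ a + c + (b + d)
    +-+-interchange = solve-∀

  leastSum-zero-below : ∀ k → k ≤ p → leastSum 0 k ≡ 0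
  leastSum-zero-below zero    _     = refl
  leastSum-zero-below (suc k) k<p = cong₂ _+_ (leastSum-zero-below k (<⇒≤ k<p)) (atLeast-< p k<p)

  leastSum-zero-full : leastSum 0 q ≡ 1
  leastSum-zero-full = cong₂ _+_ (leastSum-zero-below p ≤-refl) (atLeast-refl p)

  level : ℕ → ℕ → ℕ
  level n k = ⌊ n + (q ∸ k) /2⌋

  q∸k≡1+[p∸k] : ∀ {k} → k ≤ p → q ∸ k ≡ suc (p ∸ k)
  q∸k≡1+[p∸k] = +-∸-assoc 1

  binomMod-0-nonzero : ∀ {s} → 0 < s → s < q → binomMod q 0 s ≡ 0
  binomMod-0-nonzero {suc s} _ s<q rewrite m<n⇒m%n≡m s<q = refl

  least-0≡binomMod-0 : ∀ k → k < q → least 0 k ≡ binomMod q 0 (level 0 k)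
  least-0≡binomMod-0 k k<q with m≤n⇒m<n∨m≡n (≤-pred k<q)
  ... | inj₂ refl = trans (atLeast-refl p) (cong (λ x → binomMod q 0 ⌊ x /2⌋) (sym (m+n∸n≡m 1 p)))
  ... | inj₁ k<p = trans (atLeast-< p k<p) (sym (binomMod-0-nonzero 0<level level<q))
    where
    0<level : 0 < level 0 k
    0<level rewrite q∸k≡1+[p∸k] (<⇒≤ k<p) | q∸k≡1+[p∸k] {suc k} k<p = z<s
    level<q : level 0 k < q
    level<q rewrite q∸k≡1+[p∸k] (<⇒≤ k<p) = <-≤-trans (⌊n/2⌋<n (p ∸ k)) (s≤s (m∸n≤m p k))

  LevelFormula : ℕ → Set
  LevelFormula n = ∀ k → k < q → least n k ≡ binomMod q n (level n k)

  least-pred : ∀ n → LevelFormula n → ∀ k → k < q → least n (k ∸ 1) ≡ binomMod q n (suc ⌊ n + (p ∸ k) /2⌋)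
  least-pred n formula zero 0<q =
    trans (formula 0 0<q) (binomMod-sym n (level n 0) (suc ⌊ n + p /2⌋) (trans (cong (_% q) halves) (m+q≈m n)))
    where
    open ≡-Reasoning
    halves : level n 0 + suc ⌊ n + p /2⌋ ≡ n + q
    halves = begin
      ⌊ n + suc p /2⌋ + suc ⌊ n + p /2⌋   ≡⟨ cong (λ x → ⌊ x /2⌋ + suc ⌊ n + p /2⌋) (+-suc n p) ⟩
      ⌈ n + p /2⌉ + suc ⌊ n + p /2⌋       ≡⟨ +-suc ⌈ n + p /2⌉ ⌊ n + p /2⌋ ⟩
      suc (⌈ n + p /2⌉ + ⌊ n + p /2⌋)     ≡⟨ cong suc (trans (+-comm ⌈ n + p /2⌉ _) (⌊n/2⌋+⌈n/2⌉≡n (n + p))) ⟩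
      suc (n + p)                         ≡⟨ +-suc n p ⟨
      n + q                               ∎
  least-pred n formula (suc k) 1+k<q =
    trans (formula k (<⇒≤ 1+k<q)) (cong (λ x → binomMod q n ⌊ x /2⌋) n+[q∸k]≡)
    where
    open ≡-Reasoning
    k<p = ≤-pred 1+k<q
    n+[q∸k]≡ : n + (q ∸ k) ≡ 2 + (n + (p ∸ suc k))
    n+[q∸k]≡ = begin
      n + (q ∸ k)                ≡⟨ cong (n +_) (q∸k≡1+[p∸k] (<⇒≤ k<p)) ⟩
      n + suc (p ∸ k)            ≡⟨ cong (λ x → n + suc x) (q∸k≡1+[p∸k] k<p) ⟩
      n + suc (suc (p ∸ suc k))  ≡⟨ trans (+-suc n _) (cong suc (+-suc n _)) ⟩
      2 + (n + (p ∸ suc k))      ∎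

  least-succ : ∀ n → LevelFormula n → ∀ k → k < q → least n (suc k ⊓ p) ≡ binomMod q n ⌊ n + (p ∸ k) /2⌋
  least-succ n formula k k<q with m≤n⇒m<n∨m≡n (≤-pred k<q)
  ... | inj₁ k<p  = trans (cong (least n) (m≤n⇒m⊓n≡m k<p)) (formula (suc k) (s≤s k<p))
  ... | inj₂ refl = trans (cong (least n) (m≥n⇒m⊓n≡n (n≤1+n p)))
                          (trans (formula p k<q) (binomMod-sym n (level n p) ⌊ n + (p ∸ p) /2⌋ (cong (_% q) halves)))
    where
    open ≡-Reasoning
    halves : level n p + ⌊ n + (p ∸ p) /2⌋ ≡ n
    halves = begin
      ⌊ n + (q ∸ p) /2⌋ + ⌊ n + (p ∸ p) /2⌋  ≡⟨ cong₂ (λ a b → ⌊ n + a /2⌋ + ⌊ n + b /2⌋) (m+n∸n≡m 1 p) (n∸n≡0 p) ⟩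
      ⌊ n + 1 /2⌋ + ⌊ n + 0 /2⌋              ≡⟨ cong₂ (λ a b → ⌊ a /2⌋ + ⌊ b /2⌋) (+-comm n 1) (+-identityʳ n) ⟩
      ⌈ n /2⌉ + ⌊ n /2⌋                      ≡⟨ trans (+-comm ⌈ n /2⌉ _) (⌊n/2⌋+⌈n/2⌉≡n n) ⟩
      n                                      ∎

  least≡binomMod : ∀ n → LevelFormula n
  least≡binomMod zero    k k<q = least-0≡binomMod-0 k k<q
  least≡binomMod (suc n) k k<q = begin
    least n (k ∸ 1) + least n (suc k ⊓ p)  ≡⟨ cong₂ _+_ (least-pred n IH k k<q) (least-succ n IH k k<q) ⟩
    binomMod q n (suc m) + binomMod q n m  ≡⟨ binomMod-pascal n m ⟨
    binomMod q (suc n) (suc m)             ≡⟨ cong (binomMod q (suc n)) level≡1+m ⟨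
    binomMod q (suc n) (level (suc n) k)   ∎
    where
    open ≡-Reasoning
    IH = least≡binomMod n
    m = ⌊ n + (p ∸ k) /2⌋
    level≡1+m : level (suc n) k ≡ suc m
    level≡1+m = cong ⌊_/2⌋ (trans (cong (suc n +_) (q∸k≡1+[p∸k] (≤-pred k<q))) (cong suc (+-suc n (p ∸ k))))

  -- Subsets of ℤ_q and the inductive bound

  -- Only the values at 0, …, p matter.
  Subset : Set
  Subset = ℕ → Bool

  _∪_ _∩_ : Subset → Subset → Subset
  (s ∪ t) x = s x ∨ t x
  (s ∩ t) x = s x ∧ t x

  total : (ℕ → ℕ) → Subset → ℕ
  total f s = sumTo (λ x → when (s x) (f x)) q

  card : Subset → ℕ
  card = total (λ _ → 1)

  shift : ℕ → Subset → Subset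
  shift X s y = s ((y + X) % q)

  total-∪-∩ : ∀ f s t → total f s + total f t ≡ total f (s ∪ t) + total f (s ∩ t)
  total-∪-∩ f s t = trans (sym (sumTo-distrib-+ q))
                          (trans (sumTo-cong q (λ x _ → when-∨-∧ (s x) (t x) (f x))) (sumTo-distrib-+ q))

  card≤q : ∀ s → card s ≤ q
  card≤q s = ≤-trans (sumTo-mono-≤ q (λ x _ → when≤1 (s x))) (≤-reflexive (trans (sumTo-const 1 q) (*-identityʳ q)))

  card-∩-< : ∀ s t {y} → y < q → s y ≡ true → t y ≡ false → card (s ∩ t) < card s
  card-∩-< s t {y} y<q sy ty = sumTo-mono-< q (λ x _ → when-∧-≤ (s x) (t x)) y<q s∩t<s
    where
    s∩t<s : when (s y ∧ t y) 1 < when (s y) 1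
    s∩t<s rewrite sy | ty = z<s

  card-full : ∀ s → (∀ y → y < q → s y ≡ true) → card s ≡ q
  card-full s all = trans (sumTo-cong q (λ y y<q → cong (λ b → when b 1) (all y y<q)))
                          (trans (sumTo-const 1 q) (*-identityʳ q))

  card-empty : ∀ s → (∀ y → y < q → s y ≡ false) → card s ≡ 0
  card-empty s none = trans (sumTo-cong q (λ y y<q → cong (λ b → when b 1) (none y y<q)))
                            (trans (sumTo-const 0 q) (*-zeroʳ q))

  card<q : ∀ s {y} → y < q → s y ≡ false → card s < q
  card<q s {y} y<q sy = <-≤-trans (sumTo-mono-< q (λ x _ → when≤1 (s x)) y<q (subst (λ b → when b 1 < 1) (sym sy) z<s))
                                  (≤-reflexive (trans (sumTo-const 1 q) (*-identityʳ q)))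

  card≡q⇒∈ : ∀ s → card s ≡ q → ∀ {y} → y < q → s y ≡ true
  card≡q⇒∈ s card≡q {y} y<q with s y in sy
  ... | true  = refl
  ... | false = ⊥-elim (<-irrefl card≡q (card<q s y<q sy))

  sumTo-rotate-1 : ∀ g → sumTo (λ y → g ((y + 1) % q)) q ≡ sumTo g q
  sumTo-rotate-1 g = begin
    sumTo (λ y → g ((y + 1) % q)) p + g ((p + 1) % q)
      ≡⟨ cong₂ _+_ (sumTo-cong p (λ y y<p → cong g (trans (cong (_% q) (+-comm y 1)) (m<n⇒m%n≡m (s≤s y<p)))))
                   (cong g (trans (cong (_% q) (+-comm p 1)) (n%n≡0 q))) ⟩
    sumTo (λ y → g (suc y)) p + g 0
      ≡⟨ +-comm _ (g 0) ⟩
    g 0 + sumTo (λ y → g (suc y)) p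
      ≡⟨ sumTo-head g p ⟨
    sumTo g q
      ∎
    where open ≡-Reasoning

  sumTo-rotate : ∀ X g → sumTo (λ y → g ((y + X) % q)) q ≡ sumTo g q
  sumTo-rotate zero    g = sumTo-cong q (λ y y<q → cong g (trans (cong (_% q) (+-identityʳ y)) (m<n⇒m%n≡m y<q)))
  sumTo-rotate (suc X) g = begin
    sumTo (λ y → g ((y + suc X) % q)) q      ≡⟨ sumTo-cong q (λ y _ → cong g (sym (+1-after-+X y))) ⟩
    sumTo (λ y → g′ ((y + X) % q)) q         ≡⟨ sumTo-rotate X g′ ⟩
    sumTo g′ q                               ≡⟨ sumTo-rotate-1 g ⟩
    sumTo g q                                ∎
    where
    open ≡-Reasoning
    g′ = λ z → g ((z + 1) % q)
    +1-after-+X : ∀ y → ((y + X) % q + 1) % q ≡ (y + suc X) % q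
    +1-after-+X y = trans ([m%q+n]%q≡[m+n]%q (y + X) 1) (cong (_% q) (trans (+-assoc y X 1) (cong (y +_) (+-comm X 1))))

  card-shift : ∀ X s → card (shift X s) ≡ card s
  card-shift X s = sumTo-rotate X (λ z → when (s z) 1)

  total-shift : ∀ {f} → (∀ r r′ → r ≈ r′ → f r ≡ f r′) → ∀ {X} → X ≤ q → ∀ s →
    total (λ x → f (x + (q ∸ X))) s ≡ total f (shift X s)
  total-shift {f} f-cong {X} X≤q s = begin
    sumTo (λ x → when (s x) (f (x + (q ∸ X)))) q
      ≡⟨ sumTo-rotate X (λ x → when (s x) (f (x + (q ∸ X)))) ⟨
    sumTo (λ y → when (s ((y + X) % q)) (f ((y + X) % q + (q ∸ X)))) q
      ≡⟨ sumTo-cong q (λ y _ → cong (when (shift X s y)) (f-cong _ _ (undo y))) ⟩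
    total f (shift X s)
      ∎
    where
    open ≡-Reasoning
    undo : ∀ y → (y + X) % q + (q ∸ X) ≈ y
    undo y = trans ([m%q+n]%q≡[m+n]%q (y + X) (q ∸ X)) (m+n+[q∸n]≈m y X≤q)

  ShiftClosed : ℕ → Subset → Set
  ShiftClosed X s = ∀ y → y < q → s y ≡ true → shift X s y ≡ true

  shiftClosed⇒saturated : ∀ {X s} → Coprime X q → ShiftClosed X s →
    ∀ {y z} → y < q → z < q → s y ≡ true → s z ≡ true
  shiftClosed⇒saturated {X} {s} X⊥q closed {y} {z} y<q z<q sy =
    subst (λ w → s w ≡ true) y+tX≡z (orbit t)
    where
    orbit : ∀ t → s ((y + t * X) % q) ≡ true
    orbit zero    = subst (λ w → s w ≡ true) (sym (trans (cong (_% q) (+-identityʳ y)) (m<n⇒m%n≡m y<q))) sy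
    orbit (suc t) = subst (λ w → s w ≡ true) next (closed _ (m%n<n (y + t * X) q) (orbit t))
      where
      next : ((y + t * X) % q + X) % q ≡ (y + suc t * X) % q
      next = trans ([m%q+n]%q≡[m+n]%q (y + t * X) X)
                   (cong (_% q) (trans (+-assoc y (t * X) X) (cong (y +_) (+-comm (t * X) X))))
    t = proj₁ (coprime⇒solvable X⊥q (z + (q ∸ y)))
    y+tX≡z : (y + t * X) % q ≡ z
    y+tX≡z = begin
      (y + t * X) % q          ≡⟨ ≈-+ˡ (t * X) (z + (q ∸ y)) y (proj₂ (coprime⇒solvable X⊥q (z + (q ∸ y)))) ⟩
      (y + (z + (q ∸ y))) % q  ≡⟨ cong (_% q) (trans (sym (+-assoc y z _)) (cong (_+ (q ∸ y)) (+-comm y z))) ⟩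
      (z + y + (q ∸ y)) % q    ≡⟨ m+n+[q∸n]≈m z (<⇒≤ y<q) ⟩
      z % q                    ≡⟨ m<n⇒m%n≡m z<q ⟩
      z                        ∎
      where open ≡-Reasoning

  noEscape⇒shiftClosed : ∀ {X} s → (∀ y → y < q → s y ∧ not (shift X s y) ≡ false) → ShiftClosed X s
  noEscape⇒shiftClosed {X} s none y y<q sy with shift X s y | none y y<q
  ... | true  | _    = refl
  ... | false | nope with () ← trans (sym (cong (_∧ true) sy)) nope

  escape : ∀ {X} s → Coprime X q → 0 < card s → card s < q →
    Σ ℕ λ y → y < q × s y ≡ true × shift X s y ≡ false
  escape {X} s X⊥q 0<card card<q with find (λ y → s y ∧ not (shift X s y)) q
  ... | inj₁ (y , y<q , found) = y , y<q , ∧-not-split (s y) (shift X s y) found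
    where
    ∧-not-split : ∀ a b → a ∧ not b ≡ true → a ≡ true × b ≡ false
    ∧-not-split true false _ = refl , refl
  ... | inj₂ none = ⊥-elim (all-or-nothing (s 0) refl)
    where
    saturated = shiftClosed⇒saturated X⊥q (noEscape⇒shiftClosed s none)
    all-or-nothing : ∀ b → s 0 ≡ b → ⊥
    all-or-nothing true  s0 = <-irrefl (card-full s (λ z z<q → saturated z<s z<q s0)) card<q
    all-or-nothing false s0 = <-irrefl (sym (card-empty s empty)) 0<card
      where
      empty : ∀ y → y < q → s y ≡ false
      empty y y<q with s y in sy
      ... | false = refl
      ... | true with () ← trans (sym s0) (saturated y<q z<s sy)

  total-distrib-+ : ∀ f g s → total (λ x → f x + g x) s ≡ total f s + total g s
  total-distrib-+ f g s = trans (sumTo-cong q (λ x _ → when-distrib-+ (s x) (f x) (g x))) (sumTo-distrib-+ q)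

  Bounded : ℕ → (ℕ → ℕ) → Set
  Bounded n f = ∀ s → leastSum n (card s) ≤ total f s

  Bounded-cong : ∀ n {f g} → (∀ r → f r ≡ g r) → Bounded n f → Bounded n g
  Bounded-cong n f≡g bound s = ≤-trans (bound s) (≤-reflexive (sumTo-cong q (λ x _ → cong (when (s x)) (f≡g x))))

  bounded-base : Bounded 0 (binomMod q 0)
  bounded-base s with m≤n⇒m<n∨m≡n (card≤q s)
  ... | inj₁ card<q = ≤-trans (≤-reflexive (leastSum-zero-below (card s) (≤-pred card<q))) z≤n
  ... | inj₂ card≡q = begin
    leastSum 0 (card s)          ≡⟨ cong (leastSum 0) card≡q ⟩
    leastSum 0 q                 ≡⟨ leastSum-zero-full ⟩
    1                            ≡⟨ cong (λ b → when b 1) (card≡q⇒∈ s card≡q z<s) ⟨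
    when (s 0) (binomMod q 0 0)  ≤⟨ term≤sumTo (λ x → when (s x) (binomMod q 0 x)) z<s ⟩
    total (binomMod q 0) s       ∎
    where open ≤-Reasoning

  bounded-∪-∩ : ∀ n f → Bounded n f → ∀ s t {k} → card s ≡ suc k → card t ≡ suc k → card (s ∩ t) ≤ k →
    leastSum n (2 + k) + leastSum n k ≤ total f s + total f t
  bounded-∪-∩ n f bound s t {k} card-s card-t a≤k = begin
    leastSum n (2 + k) + leastSum n k
      ≡⟨ cong (λ z → leastSum n (2 + z) + leastSum n z) k≡a+w ⟩
    leastSum n (2 + (a + w)) + leastSum n (a + w)
      ≤⟨ leastSum-convex n a w ⟩
    leastSum n (a + (2 + (w + w))) + leastSum n a
      ≡⟨ cong (λ z → leastSum n z + leastSum n a) card-∪ ⟨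
    leastSum n (card (s ∪ t)) + leastSum n (card (s ∩ t))
      ≤⟨ +-mono-≤ (bound (s ∪ t)) (bound (s ∩ t)) ⟩
    total f (s ∪ t) + total f (s ∩ t)
      ≡⟨ total-∪-∩ f s t ⟨
    total f s + total f t
      ∎
    where
    open ≤-Reasoning
    a = card (s ∩ t)
    w = k ∸ a
    k≡a+w : k ≡ a + w
    k≡a+w = sym (m+[n∸m]≡n a≤k)
    card-∪ : card (s ∪ t) ≡ a + (2 + (w + w))
    card-∪ = +-cancelʳ-≡ a _ _ (begin-equality
      card (s ∪ t) + a             ≡⟨ total-∪-∩ (λ _ → 1) s t ⟨
      card s + card t              ≡⟨ cong₂ _+_ card-s card-t ⟩
      suc k + suc k                ≡⟨ cong (λ z → suc z + suc z) k≡a+w ⟩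
      suc (a + w) + suc (a + w)    ≡⟨ regroup a w ⟩
      a + (2 + (w + w)) + a        ∎)
      where
      regroup : ∀ a w → suc (a + w) + suc (a + w) ≡ a + (2 + (w + w)) + a
      regroup = solve-∀

  bounded-step : ∀ n f → Bounded n f → (∀ r r′ → r ≈ r′ → f r ≡ f r′) → ∀ {X} → X < q → Coprime X q →
    Bounded (suc n) (λ r → f r + f (r + (q ∸ X)))
  bounded-step n f bound f-cong {X} X<q X⊥q s = begin
    leastSum (suc n) (card s)                      ≤⟨ by-size (card s) refl ⟩
    total f s + total f t                          ≡⟨ cong (total f s +_) (total-shift f-cong (<⇒≤ X<q) s) ⟨
    total f s + total (λ x → f (x + (q ∸ X))) s    ≡⟨ total-distrib-+ f (λ x → f (x + (q ∸ X))) s ⟨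
    total (λ r → f r + f (r + (q ∸ X))) s          ∎
    where
    open ≤-Reasoning
    t = shift X s
    by-size : ∀ k → card s ≡ k → leastSum (suc n) k ≤ total f s + total f t
    by-size zero    _      = z≤n
    by-size (suc k) card-s with m≤n⇒m<n∨m≡n (subst (_≤ q) card-s (card≤q s))
    ... | inj₂ 1+k≡q = begin
      leastSum (suc n) (suc k)                        ≡⟨ cong (leastSum (suc n)) 1+k≡q ⟩
      leastSum (suc n) q                              ≡⟨ leastSum-full n ⟩
      leastSum n q + leastSum n q                     ≡⟨ cong₂ (λ a b → leastSum n a + leastSum n b) card-s=q card-t=q ⟨
      leastSum n (card s) + leastSum n (card t)       ≤⟨ +-mono-≤ (bound s) (bound t) ⟩
      total f s + total f t                           ∎
      where
      card-s=q = trans card-s 1+k≡q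
      card-t=q = trans (card-shift X s) card-s=q
    ... | inj₁ 1+k<q with escape s X⊥q (subst (0 <_) (sym card-s) z<s) (subst (_< q) (sym card-s) 1+k<q)
    ...   | y , y<q , sy , ty = begin
      leastSum (suc n) (suc k)                        ≡⟨ leastSum-suc n k 1+k<q ⟩
      leastSum n (2 + k) + leastSum n k               ≤⟨ bounded-∪-∩ n f bound s t card-s (trans (card-shift X s) card-s) a≤k ⟩
      total f s + total f t                           ∎
      where
      a≤k : card (s ∩ t) ≤ k
      a≤k = ≤-pred (subst (card (s ∩ t) <_) card-s (card-∩-< s t y<q sy ty))

  solutions-bounded : ∀ {n} (a : Vec (Fin q) n) → All Reduced a → Bounded n (solutions a)
  solutions-bounded         []      []                  = Bounded-cong 0 (λ r → sym (solutions-[] r)) bounded-base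
  solutions-bounded {suc n} (x ∷ a) (x⊥q ∷ a-reduced) = Bounded-cong (suc n) (λ r → sym (solutions-∷ x a r))
    (bounded-step n (solutions a) (solutions-bounded a a-reduced) (solutions-cong a) (toℕ<n x) x⊥q)

  singleton : ℕ → Subset
  singleton r x = x ≡ᵇ r

  lower-bound : ∀ n → p ≤ n → (a : Vec (Fin q) n) → All Reduced a → (ρ : Fin q) →
    binomMod q n (ceilHalfDiff n q) ≤ countSols q a ρ
  lower-bound n p≤n a a-reduced ρ = begin
    binomMod q n (ceilHalfDiff n q)       ≡⟨ binomMod-sym n (level n 0) (ceilHalfDiff n q) (cong (_% q) halves) ⟨
    binomMod q n (level n 0)              ≡⟨ least≡binomMod n 0 z<s ⟨
    leastSum n 1                          ≡⟨ cong (leastSum n) (sumTo-indicator (λ _ → 1) q r<q) ⟨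
    leastSum n (card (singleton r))       ≤⟨ solutions-bounded a a-reduced (singleton r) ⟩
    total (solutions a) (singleton r)     ≡⟨ sumTo-indicator (solutions a) q r<q ⟩
    solutions a r                         ≡⟨ countSols≡solutions a ρ ⟨
    countSols q a ρ                       ∎
    where
    open ≤-Reasoning
    r = toℕ ρ
    r<q = toℕ<n ρ
    halves : level n 0 + ceilHalfDiff n q ≡ n
    halves = trans (cong (level n 0 +_) (n/2≡⌊n/2⌋ (suc (n ∸ q)))) (⌊n+[1+p]/2⌋+⌈n∸[1+p]/2⌉≡n p≤n)

  ones : ∀ n → Vec (Fin q) n
  ones zero    = []
  ones (suc n) = one p ∷ ones n

  ones-reduced : ∀ n → All Reduced (ones n)
  ones-reduced zero    = []
  ones-reduced (suc n) = one-coprime p ∷ ones-reduced n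

  solutions-ones : ∀ n r → solutions (ones n) r ≡ binomMod q n r
  solutions-ones zero    r = solutions-[] r
  solutions-ones (suc n) r = begin
    solutions (ones (suc n)) r
      ≡⟨ solutions-∷ (one p) (ones n) r ⟩
    solutions (ones n) r + solutions (ones n) (r + (q ∸ toℕ (one p)))
      ≡⟨ cong₂ _+_ (solutions-ones n r) (solutions-ones n (r + (q ∸ toℕ (one p)))) ⟩
    binomMod q n r + binomMod q n (r + (q ∸ toℕ (one p)))
      ≡⟨ cong₂ _+_ (binomMod-cong n r (suc (r + p)) (sym 1+r+p≈r))
                   (binomMod-cong n (r + (q ∸ toℕ (one p))) (r + p) (r+[q∸one]≈r+p p r)) ⟩
    binomMod q n (suc (r + p)) + binomMod q n (r + p)
      ≡⟨ binomMod-pascal n (r + p) ⟨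
    binomMod q (suc n) (suc (r + p))
      ≡⟨ binomMod-cong (suc n) (suc (r + p)) r 1+r+p≈r ⟩
    binomMod q (suc n) r
      ∎
    where
    open ≡-Reasoning
    1+r+p≈r : suc (r + p) ≈ r
    1+r+p≈r = trans (cong (_% q) (sym (+-suc r p))) (m+q≈m r)

  extremal : ∀ n → Σ (Vec (Fin q) n) λ a → All Reduced a × Σ (Fin q) λ ρ →
    countSols q a ρ ≡ binomMod q n (ceilHalfDiff n q)
  extremal n = ones n , ones-reduced n , ρ , (begin
    countSols q (ones n) ρ      ≡⟨ countSols≡solutions (ones n) ρ ⟩
    solutions (ones n) (toℕ ρ)  ≡⟨ solutions-ones n (toℕ ρ) ⟩
    binomMod q n (toℕ ρ)        ≡⟨ binomMod-cong n (toℕ ρ) c (trans (cong (_% q) (toℕ-fromℕ< c%q<q)) (m%n%n≡m%n c q)) ⟩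
    binomMod q n c              ∎)
    where
    open ≡-Reasoning
    c = ceilHalfDiff n q
    c%q<q = m%n<n c q
    ρ = fromℕ< c%q<q

corollary2 : (q n : ℕ) .{{_ : NonZero q}} → q ∸ 1 ≤ n →
    ((a : Vec (Fin q) n) → All Reduced a → (ρ : Fin q) →
        binomMod q n (ceilHalfDiff n q) ≤ countSols q a ρ)
    × Σ (Vec (Fin q) n) (λ a → All Reduced a × Σ (Fin q) (λ ρ →
        countSols q a ρ ≡ binomMod q n (ceilHalfDiff n q)))
corollary2 zero    n {{q≢0}} _   = ⊥-elim-irr (NonZero.nonZero q≢0)
corollary2 (suc p) n         p≤n = lower-bound p n p≤n , extremal p n
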